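{- Let $G=(V,E)$ be an arbitrary (possibly disconnected) finite simple graph, and let $W=\{(x,y)\in V\times V \mid [x,y]\in E\}$ and $W^c=\{(x,y)\in V\times V \mid x\neq y,\ [x,y]\notin E\}$. Then there exists a finite nonempty set $M$ and a symbolic ultrametric $\delta\colon V\times V\to M\cup\{\varnothing\}$ such that $\delta(W)\cap\delta(W^c)=\emptyset$ if and only if $G$ is a cograph.
   Context: A cograph is a finite simple graph containing no induced path on four vertices ($P_4$). Let $M$ be a finite nonempty set and $\varnothing$ a special symbol not in $M$; write $M^{\varnothing}=M\cup\{\varnothing\}$. A map $\delta\colon X\times X\to M^{\varnothing}$ is a symbolic ultrametric if: (U0) $\delta(x,y)=\varnothing$ iff $x=y$; (U1) $\delta(x,y)=\delta(y,x)$ for all $x,y$; (U2) $|\{\delta(x,y),\delta(x,z),\delta(y,z)\}|\le 2$ for all $x,y,z\in X$; (U3) there is no 4-element subset $\{x,y,u,v\}\subseteq X$ with $\delta(x,y)=\delta(y,u)=\delta(u,v)\neq\delta(y,v)=\delta(x,v)=\delta(x,u)$. For $S\subseteq X\times X$, $\delta(S)=\{\delta(x,y)\mid (x,y)\in S\}$. -}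

module Defs where

open import Data.Nat using (ℕ; suc)
open import Data.Fin using (Fin)
open import Data.Bool using (Bool; true; false)
open import Data.Maybe using (Maybe; nothing; just)
open import Data.Product using (_×_; _,_; Σ; ∃-syntax)
open import Data.Sum using (_⊎_)
open import Relation.Nullary using (¬_)
open import Relation.Binary.PropositionalEquality using (_≡_; _≢_)
open import Function.Bundles using (_⇔_)

record SimpleGraph (n : ℕ) : Set where
  field
    adj   : Fin n → Fin n → Bool
    sym   : ∀ x y → adj x y ≡ adj y x
    irref : ∀ x → adj x x ≡ false

open SimpleGraph public

Edge : ∀ {n} → SimpleGraph n → Fin n → Fin n → Set
Edge G x y = adj G x y ≡ true

NonEdge : ∀ {n} → SimpleGraph n → Fin n → Fin n → Set
NonEdge G x y = adj G x y ≡ false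

Distinct4 : ∀ {n} → Fin n → Fin n → Fin n → Fin n → Set
Distinct4 a b c d =
  a ≢ b × a ≢ c × a ≢ d × b ≢ c × b ≢ d × c ≢ d

InducedP4 : ∀ {n} → SimpleGraph n → Fin n → Fin n → Fin n → Fin n → Set
InducedP4 G a b c d =
  Distinct4 a b c d ×
  Edge G a b × Edge G b c × Edge G c d ×
  NonEdge G a c × NonEdge G b d × NonEdge G a d

IsCograph : ∀ {n} → SimpleGraph n → Set
IsCograph {n} G = ¬ (Σ (Fin n) λ a → Σ (Fin n) λ b → Σ (Fin n) λ c →
                      Σ (Fin n) λ d → InducedP4 G a b c d)

-- Symbolic ultrametric with values in M ∪ {∅}, where M^∅ = Maybe M and ∅ = nothing.
record IsSymbolicUltrametric {X M : Set} (δ : X → X → Maybe M) : Set where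
  field
    U0 : ∀ x y → (δ x y ≡ nothing) ⇔ (x ≡ y)
    U1 : ∀ x y → δ x y ≡ δ y x
    -- |{δ(x,y), δ(x,z), δ(y,z)}| ≤ 2, i.e. two of the three values coincide
    U2 : ∀ x y z → (δ x y ≡ δ x z) ⊎ (δ x y ≡ δ y z) ⊎ (δ x z ≡ δ y z)
    U3 : ∀ x y u v → x ≢ y → x ≢ u → x ≢ v → y ≢ u → y ≢ v → u ≢ v →
         ¬ (δ x y ≡ δ y u × δ y u ≡ δ u v × δ u v ≢ δ y v ×
            δ y v ≡ δ x v × δ x v ≡ δ x u)

DisjointImages : ∀ {n} {M : Set} → SimpleGraph n → (Fin n → Fin n → Maybe M) → Set
DisjointImages {n} G δ =
  ∀ (x y u v : Fin n) → Edge G x y → u ≢ v → NonEdge G u v → δ x y ≢ δ u v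

module Submission where

open import Defs hiding (sym)
open import Data.Nat using (ℕ; suc)
open import Data.Fin using (Fin; _≟_)
open import Data.Fin.Properties using (2↔Bool)
open import Data.Maybe using (Maybe; nothing; just)
open import Data.Maybe.Properties using (just-injective)
open import Data.Product using (Σ; _×_; _,_)
open import Data.Sum using (_⊎_; inj₁; inj₂; map)
open import Data.Bool using (Bool; true; false; not)
open import Data.Bool.Properties using (¬-not)
open import Relation.Nullary using (¬_; Dec; yes; no; contradiction)
open import Relation.Binary.PropositionalEquality
  using (_≡_; _≢_; refl; sym; trans; cong; ≢-sym)
open import Function.Bundles using (_⇔_; mk⇔; _↣_; Injection)
open import Function.Properties.Inverse using (↔-sym; Inverse⇒Injection)

-- On an induced path a - b - c - d, a symbolic ultrametric separating edges
-- from non-edges is forced by U2 to make the triangles abc, bcd, acd and abd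
-- isosceles, with legs of one kind and base of the other; the values so
-- obtained form exactly the pattern excluded by U3.  Conversely, labelling
-- distinct pairs by adjacency satisfies U0-U2 on every graph, and a U3
-- pattern for it is an induced P4 of G or of its complement, the latter
-- being again an induced P4 of G because P4 is self-complementary.

HasInducedP4 : ∀ {n} → SimpleGraph n → Set
HasInducedP4 {n} G = Σ (Fin n) λ a → Σ (Fin n) λ b → Σ (Fin n) λ c →
                     Σ (Fin n) λ d → InducedP4 G a b c d

module _ {n} (G : SimpleGraph n) where

  adj-swap : ∀ {x y b} → adj G x y ≡ b → adj G y x ≡ b
  adj-swap {x} {y} e = trans (SimpleGraph.sym G y x) e

  Edge⇒≢ : ∀ {x y} → Edge G x y → x ≢ y
  Edge⇒≢ {x} e refl with trans (sym e) (irref G x)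
  ... | ()

  alternating⇒InducedP4 : ∀ {x y u v} b → Distinct4 x y u v →
    adj G x y ≡ b → adj G y u ≡ b → adj G u v ≡ b →
    adj G y v ≡ not b → adj G x v ≡ not b → adj G x u ≡ not b →
    HasInducedP4 G
  alternating⇒InducedP4 {x} {y} {u} {v} true distinct xy yu uv yv xv xu =
    x , y , u , v , distinct , xy , yu , uv , xu , yv , xv
  -- the complement of the path x - y - u - v is the path u - x - v - y
  alternating⇒InducedP4 {x} {y} {u} {v} false (x≢y , x≢u , x≢v , y≢u , y≢v , u≢v)
    xy yu uv yv xv xu =
    u , x , v , y , (≢-sym x≢u , u≢v , ≢-sym y≢u , x≢v , x≢y , ≢-sym y≢v) ,
    adj-swap xu , xv , adj-swap yv , uv , xy , adj-swap yu

isosceles : ∀ {X M} {δ : X → X → Maybe M} → IsSymbolicUltrametric δ →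
  ∀ x y z → δ y z ≢ δ y x → δ y z ≢ δ x z → δ y x ≡ δ x z
isosceles ultrametric x y z base≢yx base≢xz with IsSymbolicUltrametric.U2 ultrametric y x z
... | inj₁ yx≡yz          = contradiction (sym yx≡yz) base≢yx
... | inj₂ (inj₁ yx≡xz) = yx≡xz
... | inj₂ (inj₂ yz≡xz) = contradiction yz≡xz base≢xz

separating⇒cograph : ∀ {n M} (G : SimpleGraph n) (δ : Fin n → Fin n → Maybe M) →
  IsSymbolicUltrametric δ → DisjointImages G δ → IsCograph G
separating⇒cograph G δ ultrametric separates
  (a , b , c , d , (a≢b , a≢c , a≢d , b≢c , b≢d , c≢d) , ab , bc , cd , ac , bd , ad) =
  U3 a b c d a≢b a≢c a≢d b≢c b≢d c≢d
    (δab≡δbc , δbc≡δcd , separates c d b d cd b≢d bd , δbd≡δad , δad≡δac)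
  where
  open IsSymbolicUltrametric ultrametric

  δab≡δbc : δ a b ≡ δ b c
  δab≡δbc = isosceles ultrametric b a c
    (≢-sym (separates a b a c ab a≢c ac)) (≢-sym (separates b c a c bc a≢c ac))

  δbc≡δcd : δ b c ≡ δ c d
  δbc≡δcd = isosceles ultrametric c b d
    (≢-sym (separates b c b d bc b≢d bd)) (≢-sym (separates c d b d cd b≢d bd))

  δbd≡δad : δ b d ≡ δ a d
  δbd≡δad = trans (U1 b d) (sym (isosceles ultrametric d a b
    (separates a b a d ab a≢d ad) (separates a b d b ab (≢-sym b≢d) (adj-swap G bd))))

  δad≡δac : δ a d ≡ δ a c
  δad≡δac = trans (sym (isosceles ultrametric a c d
    (separates c d c a cd (≢-sym a≢c) (adj-swap G ac)) (separates c d a d cd a≢d ad)))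
    (U1 c a)

bool-pigeonhole : (a b c : Bool) → (a ≡ b) ⊎ (a ≡ c) ⊎ (b ≡ c)
bool-pigeonhole true  true  _     = inj₁ refl
bool-pigeonhole false false _     = inj₁ refl
bool-pigeonhole true  false true  = inj₂ (inj₁ refl)
bool-pigeonhole true  false false = inj₂ (inj₂ refl)
bool-pigeonhole false true  true  = inj₂ (inj₂ refl)
bool-pigeonhole false true  false = inj₂ (inj₁ refl)

Bool↣Fin2 : Bool ↣ Fin 2
Bool↣Fin2 = Inverse⇒Injection (↔-sym 2↔Bool)

module AdjacencyLabelling {n} (G : SimpleGraph n) where

  open Injection Bool↣Fin2 using (injective) renaming (to to label)

  δ-adj : Fin n → Fin n → Maybe (Fin 2)
  δ-adj x y with x ≟ y
  ... | yes _ = nothing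
  ... | no _  = just (label (adj G x y))

  δ-adj-diagonal : ∀ x → δ-adj x x ≡ nothing
  δ-adj-diagonal x with x ≟ x
  ... | yes _   = refl
  ... | no x≢x = contradiction refl x≢x

  δ-adj-offDiagonal : ∀ {x y} → x ≢ y → δ-adj x y ≡ just (label (adj G x y))
  δ-adj-offDiagonal {x} {y} x≢y with x ≟ y
  ... | yes x≡y = contradiction x≡y x≢y
  ... | no _    = refl

  δ-adj-cong : ∀ {x y u v} → x ≢ y → u ≢ v →
    adj G x y ≡ adj G u v → δ-adj x y ≡ δ-adj u v
  δ-adj-cong x≢y u≢v e = trans (δ-adj-offDiagonal x≢y)
    (trans (cong (λ b → just (label b)) e) (sym (δ-adj-offDiagonal u≢v)))

  δ-adj-injective : ∀ {x y u v} → x ≢ y → u ≢ v →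
    δ-adj x y ≡ δ-adj u v → adj G x y ≡ adj G u v
  δ-adj-injective x≢y u≢v e = injective (just-injective
    (trans (sym (δ-adj-offDiagonal x≢y)) (trans e (δ-adj-offDiagonal u≢v))))

  δ-adj-nothing⇔≡ : ∀ x y → (δ-adj x y ≡ nothing) ⇔ (x ≡ y)
  δ-adj-nothing⇔≡ x y = mk⇔ to (λ { refl → δ-adj-diagonal x })
    where
    to : δ-adj x y ≡ nothing → x ≡ y
    to e with x ≟ y
    to _  | yes x≡y = x≡y
    to () | no _

  δ-adj-sym : ∀ x y → δ-adj x y ≡ δ-adj y x
  δ-adj-sym x y = by-cases (x ≟ y)
    where
    by-cases : Dec (x ≡ y) → δ-adj x y ≡ δ-adj y x
    by-cases (yes refl) = refl
    by-cases (no x≢y)   = δ-adj-cong x≢y (≢-sym x≢y) (SimpleGraph.sym G x y)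

  δ-adj-twoValues : ∀ x y z →
    (δ-adj x y ≡ δ-adj x z) ⊎ (δ-adj x y ≡ δ-adj y z) ⊎ (δ-adj x z ≡ δ-adj y z)
  δ-adj-twoValues x y z = by-cases (x ≟ y) (x ≟ z) (y ≟ z)
    where
    by-cases : Dec (x ≡ y) → Dec (x ≡ z) → Dec (y ≡ z) →
      (δ-adj x y ≡ δ-adj x z) ⊎ (δ-adj x y ≡ δ-adj y z) ⊎ (δ-adj x z ≡ δ-adj y z)
    by-cases (yes refl) _          _          = inj₂ (inj₂ refl)
    by-cases (no _)     (yes refl) _          = inj₂ (inj₁ (δ-adj-sym x y))
    by-cases (no _)     (no _)     (yes refl) = inj₁ refl
    by-cases (no x≢y)   (no x≢z)   (no y≢z)   =
      map (δ-adj-cong x≢y x≢z) (map (δ-adj-cong x≢y y≢z) (δ-adj-cong x≢z y≢z))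
        (bool-pigeonhole (adj G x y) (adj G x z) (adj G y z))

  δ-adj-noAlternating : IsCograph G → ∀ x y u v →
    x ≢ y → x ≢ u → x ≢ v → y ≢ u → y ≢ v → u ≢ v →
    ¬ (δ-adj x y ≡ δ-adj y u × δ-adj y u ≡ δ-adj u v × δ-adj u v ≢ δ-adj y v ×
       δ-adj y v ≡ δ-adj x v × δ-adj x v ≡ δ-adj x u)
  δ-adj-noAlternating cograph x y u v x≢y x≢u x≢v y≢u y≢v u≢v
    (xy≡yu , yu≡uv , uv≢yv , yv≡xv , xv≡xu) =
    cograph (alternating⇒InducedP4 G (adj G u v) (x≢y , x≢u , x≢v , y≢u , y≢v , u≢v)
      (trans xy≡yu′ yu≡uv′) yu≡uv′ refl yv≡¬uv (trans (sym yv≡xv′) yv≡¬uv)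
      (trans (sym xv≡xu′) (trans (sym yv≡xv′) yv≡¬uv)))
    where
    xy≡yu′ : adj G x y ≡ adj G y u
    xy≡yu′ = δ-adj-injective x≢y y≢u xy≡yu
    yu≡uv′ : adj G y u ≡ adj G u v
    yu≡uv′ = δ-adj-injective y≢u u≢v yu≡uv
    yv≡xv′ : adj G y v ≡ adj G x v
    yv≡xv′ = δ-adj-injective y≢v x≢v yv≡xv
    xv≡xu′ : adj G x v ≡ adj G x u
    xv≡xu′ = δ-adj-injective x≢v x≢u xv≡xu
    yv≡¬uv : adj G y v ≡ not (adj G u v)
    yv≡¬uv = ¬-not (λ e → uv≢yv (sym (δ-adj-cong y≢v u≢v e)))

  δ-adj-isSymbolicUltrametric : IsCograph G → IsSymbolicUltrametric δ-adj
  δ-adj-isSymbolicUltrametric cograph = record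
    { U0 = δ-adj-nothing⇔≡
    ; U1 = δ-adj-sym
    ; U2 = δ-adj-twoValues
    ; U3 = δ-adj-noAlternating cograph
    }

  δ-adj-separates : DisjointImages G δ-adj
  δ-adj-separates x y u v xy u≢v uv δxy≡δuv
    with trans (sym xy) (trans (δ-adj-injective (Edge⇒≢ G xy) u≢v δxy≡δuv) uv)
  ... | ()

open AdjacencyLabelling using (δ-adj; δ-adj-isSymbolicUltrametric; δ-adj-separates)

theorem3 : ∀ (n : ℕ) (G : SimpleGraph n) →
    (Σ ℕ λ m → Σ (Fin n → Fin n → Maybe (Fin (suc m))) λ δ →
       IsSymbolicUltrametric δ × DisjointImages G δ)
    ⇔ IsCograph G
theorem3 n G = mk⇔
  (λ { (_ , δ , ultrametric , separates) → separating⇒cograph G δ ultrametric separates })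
  (λ cograph → 1 , δ-adj G , δ-adj-isSymbolicUltrametric G cograph , δ-adj-separates G)
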